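{- Let $\mathbf{x}$ be a factor-balanced infinite word and let $\mathbf{y}$ be a recurrent infinite word with $\mathcal{L}(\mathbf{y})\subseteq\mathcal{L}(\mathbf{x})$. Then: (1) $\mathbf{y}$ is uniformly recurrent; (2) for every recurrent infinite word $\mathbf{y}'$ with $\mathcal{L}(\mathbf{y}')\subseteq\mathcal{L}(\mathbf{x})$, we have $\mathcal{L}(\mathbf{y})=\mathcal{L}(\mathbf{y}')$. In particular, every factor-balanced recurrent infinite word is uniformly recurrent.
   Context: $\mathcal{L}(\mathbf{x})$ is the set of finite factors of $\mathbf{x}$. An infinite word is recurrent if every factor occurs infinitely often, and uniformly recurrent if for every factor $w$ there is $k$ such that $w$ occurs in every length-$k$ factor. $\mathbf{x}$ is factor-balanced if for each finite word $w$ there is $C_w>0$ with $\big||u|_w-|v|_w\big|\le C_w$ for all $u,v\in\mathcal{L}(\mathbf{x})$ of equal length, where $|u|_w$ counts (possibly overlapping) occurrences. -}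

module Defs where

open import Data.Nat using (ℕ; zero; suc; _+_; _≤_; _<_; ∣_-_∣)
open import Data.Fin using (Fin)
open import Data.Fin.Properties using (_≟_)
open import Data.List using (List; []; _∷_; length; take)
open import Data.List.Properties using (≡-dec)
open import Data.Product using (Σ; ∃; ∃-syntax; _×_; _,_)
open import Relation.Binary.PropositionalEquality using (_≡_)
open import Relation.Nullary using (yes; no)

Letter : ℕ → Set
Letter d = Fin d

Word : ℕ → Set
Word d = List (Letter d)

InfWord : ℕ → Set
InfWord d = ℕ → Letter d

slice : ∀ {d} → InfWord d → ℕ → ℕ → Word d
slice x i zero    = []
slice x i (suc n) = x i ∷ slice x (suc i) n

OccursAt : ∀ {d} → InfWord d → Word d → ℕ → Set
OccursAt x w i = slice x i (length w) ≡ w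

_∈L_ : ∀ {d} → Word d → InfWord d → Set
w ∈L x = ∃[ i ] OccursAt x w i

_⊆L_ : ∀ {d} → InfWord d → InfWord d → Set
y ⊆L x = ∀ w → w ∈L y → w ∈L x

_≡L_ : ∀ {d} → InfWord d → InfWord d → Set
y ≡L y' = (y ⊆L y') × (y' ⊆L y)

Recurrent : ∀ {d} → InfWord d → Set
Recurrent x = ∀ w → w ∈L x → ∀ n → ∃[ i ] (n ≤ i × OccursAt x w i)

data _≼_ {d} : Word d → Word d → Set where
  here  : ∀ {w u} → take (length w) u ≡ w → w ≼ u
  there : ∀ {w a u} → w ≼ u → w ≼ (a ∷ u)

UniformlyRecurrent : ∀ {d} → InfWord d → Set
UniformlyRecurrent x = ∀ w → w ∈L x → ∃[ k ] (∀ i → w ≼ slice x i k)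

-- Number of (possibly overlapping) occurrences |u|_w of w in u:
-- the number of positions j (0 ≤ j ≤ |u|) with u[j .. j+|w|) = w.
-- (take (length w) v ≡ w holds exactly when w is a prefix of v.)
prefixCount : ∀ {d} → Word d → Word d → ℕ
prefixCount w v with ≡-dec _≟_ (take (length w) v) w
... | yes _ = 1
... | no  _ = 0

occ : ∀ {d} → Word d → Word d → ℕ
occ w []      = prefixCount w []
occ w (a ∷ u) = prefixCount w (a ∷ u) + occ w u

FactorBalanced : ∀ {d} → InfWord d → Set
FactorBalanced x = ∀ w → ∃[ C ] (0 < C × (∀ u v → u ∈L x → v ∈L x →
  length u ≡ length v → ∣ occ w u - occ w v ∣ ≤ C))

-- If w occurs in y, recurrence puts more than C_w occurrences of w into some
-- factor u of y, hence of x. Balance then forces every factor of x of length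
-- |u| to contain w, so every length-|u| window of any y' with L(y') ⊆ L(x)
-- contains w: for y' = y this is uniform recurrence, and in general it gives
-- L(y) ⊆ L(y'); exchanging y and y' gives equality.
module Submission where

open import Defs
open import Data.Nat using (ℕ; zero; suc; _+_; _∸_; _≤_; _<_; z≤n; s≤s; ∣_-_∣)
open import Data.Nat.Properties
  using (0<1+n; ≤-refl; ≤-trans; <-irrefl; m≤m+n; m≤n+m; n≤1+n; m⊓n≤n;
         m∸n+n≡m; +-suc; module ≤-Reasoning; ∣-∣-identityʳ)
open import Data.Fin.Properties using (_≟_)
open import Data.List using ([]; _∷_; length; take)
open import Data.List.Properties using (≡-dec; length-take)
open import Data.Product using (_×_; _,_; ∃-syntax)
open import Data.Empty using (⊥-elim)
open import Relation.Nullary using (yes; no)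
open import Relation.Binary.PropositionalEquality
  using (_≡_; refl; sym; trans; cong; subst)

∣m-n∣<m⇒0<n : ∀ {m n} → ∣ m - n ∣ < m → 0 < n
∣m-n∣<m⇒0<n {m} {zero}  lt = ⊥-elim (<-irrefl (∣-∣-identityʳ m) lt)
∣m-n∣<m⇒0<n {n = suc n} _  = 0<1+n

OccursInfinitelyOften : ∀ {d} → InfWord d → Word d → Set
OccursInfinitelyOften y w = ∀ m → ∃[ j ] (m ≤ j × OccursAt y w j)

OccUnbounded : ∀ {d} → InfWord d → Word d → Set
OccUnbounded x w = ∀ c → ∃[ u ] (u ∈L x × c ≤ occ w u)

module _ {d : ℕ} where

  prefix⇒length≤ : ∀ {w u : Word d} → take (length w) u ≡ w → length w ≤ length u
  prefix⇒length≤ {w} {u} p =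
    subst (_≤ length u) (trans (sym (length-take (length w) u)) (cong length p)) (m⊓n≤n _ _)

  length-slice : ∀ (y : InfWord d) i n → length (slice y i n) ≡ n
  length-slice y i zero    = refl
  length-slice y i (suc n) = cong suc (length-slice y (suc i) n)

  slice-∈L : ∀ (y : InfWord d) i n → slice y i n ∈L y
  slice-∈L y i n = i , cong (slice y i) (length-slice y i n)

  take-slice : ∀ (y : InfWord d) {k n} i → k ≤ n → take k (slice y i n) ≡ slice y i k
  take-slice y i z≤n       = refl
  take-slice y i (s≤s k≤n) = cong (y i ∷_) (take-slice y (suc i) k≤n)

  ≼-slice⇒∈L : ∀ (y : InfWord d) {w} i n → w ≼ slice y i n → w ∈L y
  ≼-slice⇒∈L y i (suc n) (there p) = ≼-slice⇒∈L y (suc i) n p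
  ≼-slice⇒∈L y {w} i n (here p) = i , trans (sym (take-slice y i w≤n)) p
    where
    w≤n : length w ≤ n
    w≤n = subst (length w ≤_) (length-slice y i n) (prefix⇒length≤ p)

  prefix⇒prefixCount≡1 : ∀ {w u : Word d} → take (length w) u ≡ w → prefixCount w u ≡ 1
  prefix⇒prefixCount≡1 {w} {u} p with ≡-dec _≟_ (take (length w) u) w
  ... | yes _ = refl
  ... | no ¬p = ⊥-elim (¬p p)

  occ>0⇒≼ : ∀ (w u : Word d) → 0 < occ w u → w ≼ u
  occ>0⇒≼ w []      occ>0 with ≡-dec _≟_ (take (length w) []) w
  ... | yes p = here p
  occ>0⇒≼ w []      ()    | no _
  occ>0⇒≼ w (a ∷ u) occ>0 with ≡-dec _≟_ (take (length w) (a ∷ u)) w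
  ... | yes p = here p
  ... | no _  = there (occ>0⇒≼ w u occ>0)

  occ-slice-extendˡ : ∀ (y : InfWord d) w k i n →
    occ w (slice y (k + i) n) ≤ occ w (slice y i (k + n))
  occ-slice-extendˡ y w zero    i n = ≤-refl
  occ-slice-extendˡ y w (suc k) i n = begin
    occ w (slice y (suc k + i) n)   ≡⟨ cong (λ j → occ w (slice y j n)) (sym (+-suc k i)) ⟩
    occ w (slice y (k + suc i) n)   ≤⟨ occ-slice-extendˡ y w k (suc i) n ⟩
    occ w (slice y (suc i) (k + n)) ≤⟨ m≤n+m _ _ ⟩
    occ w (slice y i (suc k + n))   ∎
    where open ≤-Reasoning

  occurs⇒prefixCount-slice≡1 : ∀ (y : InfWord d) {w j n} → OccursAt y w j → length w ≤ n →
    prefixCount w (slice y j n) ≡ 1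
  occurs⇒prefixCount-slice≡1 y {j = j} occurs w≤n =
    prefix⇒prefixCount≡1 (trans (take-slice y j w≤n) occurs)

  -- The lower bound ℓ on the length lets the induction step count the occurrence
  -- of w at j, which needs the window starting at j to have length at least |w|.
  occ-slice-unbounded : ∀ (y : InfWord d) {w} → OccursInfinitelyOften y w →
    ∀ c i ℓ → ∃[ n ] (ℓ ≤ n × c ≤ occ w (slice y i n))
  occ-slice-unbounded y     often zero    i ℓ = ℓ , ≤-refl , z≤n
  occ-slice-unbounded y {w} often (suc c) i ℓ
    with often i
  ... | j , i≤j , occurs
    with occ-slice-unbounded y often c (suc j) (ℓ + length w)
  ... | n , ℓ+w≤n , c≤occ = j ∸ i + suc n , ℓ≤ , suc-c≤occ
    where
    ℓ+w≤1+n : ℓ + length w ≤ suc n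
    ℓ+w≤1+n = ≤-trans ℓ+w≤n (n≤1+n n)
    ℓ≤ : ℓ ≤ j ∸ i + suc n
    ℓ≤ = ≤-trans (m≤m+n ℓ (length w)) (≤-trans ℓ+w≤1+n (m≤n+m _ _))
    prefixCount≡1 : prefixCount w (slice y j (suc n)) ≡ 1
    prefixCount≡1 = occurs⇒prefixCount-slice≡1 y occurs (≤-trans (m≤n+m (length w) ℓ) ℓ+w≤1+n)
    suc-c≤occ : suc c ≤ occ w (slice y i (j ∸ i + suc n))
    suc-c≤occ = begin
      suc c                                 ≤⟨ s≤s c≤occ ⟩
      1 + occ w (slice y (suc j) n)         ≡⟨ cong (_+ occ w (slice y (suc j) n)) (sym prefixCount≡1) ⟩
      occ w (slice y j (suc n))             ≡⟨ cong (λ k → occ w (slice y k (suc n))) (sym (m∸n+n≡m i≤j)) ⟩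
      occ w (slice y (j ∸ i + i) (suc n))   ≤⟨ occ-slice-extendˡ y w (j ∸ i) i (suc n) ⟩
      occ w (slice y i (j ∸ i + suc n))     ∎
      where open ≤-Reasoning

  occurs-infinitely-often⇒occ-unbounded : ∀ {x y : InfWord d} {w} → OccursInfinitelyOften y w →
    y ⊆L x → OccUnbounded x w
  occurs-infinitely-often⇒occ-unbounded {y = y} often y⊆x c
    with occ-slice-unbounded y often c 0 0
  ... | n , _ , c≤occ = slice y 0 n , y⊆x _ (slice-∈L y 0 n) , c≤occ

  balanced⇒long-factors-contain : ∀ {x : InfWord d} {w} → FactorBalanced x → OccUnbounded x w →
    ∃[ n ] (∀ v → v ∈L x → length v ≡ n → w ≼ v)
  balanced⇒long-factors-contain {w = w} balanced unbounded with balanced w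
  ... | C , _ , bound with unbounded (suc C)
  ... | u , u∈L , C<occ = length u , λ v v∈L |v|≡|u| →
    occ>0⇒≼ w v (∣m-n∣<m⇒0<n (≤-trans (s≤s (bound u v u∈L v∈L (sym |v|≡|u|))) C<occ))

  recurrent-factor-in-every-window : ∀ {x y z : InfWord d} → FactorBalanced x →
    Recurrent y → y ⊆L x → z ⊆L x → ∀ w → w ∈L y → ∃[ n ] (∀ i → w ≼ slice z i n)
  recurrent-factor-in-every-window {z = z} balanced recurrent y⊆x z⊆x w w∈y
    with balanced⇒long-factors-contain balanced
           (occurs-infinitely-often⇒occ-unbounded (recurrent w w∈y) y⊆x)
  ... | n , contains = n , λ i → contains (slice z i n) (z⊆x _ (slice-∈L z i n)) (length-slice z i n)

  recurrent-⊆L : ∀ {x y z : InfWord d} → FactorBalanced x → Recurrent y → y ⊆L x → z ⊆L x → y ⊆L z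
  recurrent-⊆L {z = z} balanced recurrent y⊆x z⊆x w w∈y
    with recurrent-factor-in-every-window balanced recurrent y⊆x z⊆x w w∈y
  ... | n , contains = ≼-slice⇒∈L z 0 n (contains 0)

proposition4p6 : ∀ {d : ℕ} (x y : InfWord d) → FactorBalanced x → Recurrent y → y ⊆L x →
    UniformlyRecurrent y × (∀ (y' : InfWord d) → Recurrent y' → y' ⊆L x → y ≡L y')
proposition4p6 x y balanced recurrent y⊆x =
  recurrent-factor-in-every-window balanced recurrent y⊆x y⊆x ,
  λ y' recurrent' y'⊆x → recurrent-⊆L balanced recurrent y⊆x y'⊆x ,
                         recurrent-⊆L balanced recurrent' y'⊆x y⊆x
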